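{- Let $t\le d$ be positive integers. (i) If a $d$-dimensional simplicial complex is $t$-constructible, then for every $0\le k\le d$ its $k$-skeleton is strongly connected. (ii) If a $d$-pseudomanifold is $t$-LC, then for every $0\le k\le d$ its $k$-skeleton is strongly connected.
   Context: A pure $k$-dimensional complex is strongly connected if its dual graph (vertices = $k$-faces, two adjacent when they share a $(k-1)$-face) is connected. Constructible: every simplex and every $0$-complex is constructible; a pure $d$-dimensional simplicial complex $C$ that is not a simplex is constructible iff $C=C_1\cup C_2$ with $C_1,C_2$ constructible $d$-complexes and $C_1\cap C_2$ a pure constructible $(d-1)$-complex. $t$-constructible ($t\le d$): every simplex is $t$-constructible; a $1$-dimensional complex is $t$-constructible iff connected; a pure $d$-dimensional simplicial complex $C$ that is not a simplex is $t$-constructible iff $C=C_1\cup C_2$ with $C_1,C_2$ $t$-constructible $d$-complexes and $C_1\cap C_2$ a pure $(d-1)$-complex whose $(d-t)$-skeleton is constructible. A simplicial regular CW-complex is a finite regular CW-complex in which for every proper face $F$ the interval $[\emptyset,F]$ of the face poset is Boolean. A $d$-pseudomanifold is a finite simplicial regular CW-complex, pure $d$-dimensional, in which every $(d-1)$-cell lies in at most two $d$-cells; boundary $(d-1)$-faces lie in exactly one $d$-cell. A tree of $d$-simplices is a simplicial complex triangulating the $d$-ball whose dual graph is a tree. For $t\in\{1,\dots,d\}$ a $d$-pseudomanifold is $t$-LC if it is obtainable from a tree of $d$-simplices by recursively identifying two boundary $(d-1)$-faces whose intersection has dimension at least $d-1-t$ (glued faces become interior). -}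

module Defs where

open import Data.Nat using (ℕ; zero; suc; _≤_; _∸_)
open import Data.Nat.Properties using (≤-trans)
open import Data.Fin using (Fin)
open import Data.Fin.Subset using (Subset; _⊆_; _∩_; _∪_; ⁅_⁆; ∣_∣; _∈_; _∉_)
open import Data.Fin.Subset.Properties using (p⊆q⇒∣p∣≤∣q∣)
open import Data.Product using (Σ; ∃; ∃₂; _×_; _,_; proj₁; proj₂)
open import Data.Sum using (_⊎_)
open import Relation.Binary.PropositionalEquality using (_≡_)
open import Relation.Nullary using (¬_)
open import Relation.Binary.Construct.Closure.ReflexiveTransitive using (Star)
open import Relation.Binary.Construct.Closure.Equivalence using (EqClosure)

-- Finite abstract simplicial complexes on the vertex set Fin n.
-- A face is a subset of Fin n; a k-face has k+1 vertices.

record Complex (n : ℕ) : Set₁ where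
  field
    face   : Subset n → Set
    closed : ∀ {F G} → G ⊆ F → face F → face G
open Complex public

module _ {n : ℕ} where

  IsFace : ℕ → Complex n → Subset n → Set
  IsFace k C F = face C F × ∣ F ∣ ≡ suc k

  HasDim : ℕ → Complex n → Set
  HasDim d C = (∃ λ F → IsFace d C F) × (∀ F → face C F → ∣ F ∣ ≤ suc d)

  Pure : ℕ → Complex n → Set
  Pure d C = HasDim d C × (∀ F → face C F → ∃ λ G → IsFace d C G × F ⊆ G)

  IsSimplex : Complex n → Set
  IsSimplex C = ∃ λ σ → ∀ F → (face C F → F ⊆ σ) × (F ⊆ σ → face C F)

  IsUnion : Complex n → Complex n → Complex n → Set
  IsUnion C C₁ C₂ = ∀ F → (face C F → face C₁ F ⊎ face C₂ F)
                        × (face C₁ F ⊎ face C₂ F → face C F)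

  IsInter : Complex n → Complex n → Complex n → Set
  IsInter D C₁ C₂ = ∀ F → (face D F → face C₁ F × face C₂ F)
                        × (face C₁ F × face C₂ F → face D F)

  skel : ℕ → Complex n → Complex n
  skel k C = record
    { face   = λ F → face C F × ∣ F ∣ ≤ suc k
    ; closed = λ G⊆F (fF , le) → closed C G⊆F fF , ≤-trans (p⊆q⇒∣p∣≤∣q∣ G⊆F) le }

  DualAdj : ℕ → Complex n → Subset n → Subset n → Set
  DualAdj k C F G = IsFace k C F × IsFace k C G × ∣ F ∩ G ∣ ≡ k

  StronglyConnected : ℕ → Complex n → Set
  StronglyConnected k C =
    ∀ F G → IsFace k C F → IsFace k C G → Star (DualAdj k C) F G

  Connected : Complex n → Set
  Connected C = ∀ u v → face C ⁅ u ⁆ → face C ⁅ v ⁆ →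
    Star (λ a b → face C (⁅ a ⁆ ∪ ⁅ b ⁆)) u v

data Constructible {n : ℕ} : ℕ → Complex n → Set₁ where
  simplex : ∀ {d C} → IsSimplex C → HasDim d C → Constructible d C
  points  : ∀ {C} → HasDim 0 C → Constructible 0 C
  glue    : ∀ {d C C₁ C₂ D} →
            Pure (suc d) C → ¬ IsSimplex C →
            Constructible (suc d) C₁ → Constructible (suc d) C₂ →
            IsUnion C C₁ C₂ → IsInter D C₁ C₂ →
            Pure d D → Constructible d D →
            Constructible (suc d) C

data TConstructible {n : ℕ} (t : ℕ) : ℕ → Complex n → Set₁ where
  simplex : ∀ {d C} → IsSimplex C → HasDim d C → TConstructible t d C
  graph   : ∀ {C} → HasDim 1 C → Connected C → TConstructible t 1 C
  glue    : ∀ {d C C₁ C₂ D} →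
            Pure (suc (suc d)) C → ¬ IsSimplex C →
            TConstructible t (suc (suc d)) C₁ → TConstructible t (suc (suc d)) C₂ →
            IsUnion C C₁ C₂ → IsInter D C₁ C₂ →
            Pure (suc d) D →
            Constructible (suc (suc d) ∸ t) (skel (suc (suc d) ∸ t) D) →
            TConstructible t (suc (suc d)) C

-- Trees of d-simplices (combinatorial description: start from a d-simplex,
-- repeatedly attach a new d-simplex along a boundary (d-1)-face, with a new apex)

module _ {n : ℕ} where

  BoundaryFacet : ℕ → Complex n → Subset n → Set
  BoundaryFacet d C F = face C F × ∣ F ∣ ≡ d ×
    ∃ λ σ → IsFace d C σ × F ⊆ σ × (∀ τ → IsFace d C τ → F ⊆ τ → τ ≡ σ)

data TreeOfSimplices {n : ℕ} (d : ℕ) : Complex n → Set₁ where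
  single : ∀ {C} → IsSimplex C → HasDim d C → TreeOfSimplices d C
  attach : ∀ {C' C} → TreeOfSimplices d C' →
           (F : Subset n) (v : Fin n) →
           BoundaryFacet d C' F → ¬ face C' ⁅ v ⁆ →
           (∀ G → (face C G → face C' G ⊎ G ⊆ (F ∪ ⁅ v ⁆))
                × (face C' G ⊎ G ⊆ (F ∪ ⁅ v ⁆) → face C G)) →
           TreeOfSimplices d C

-- Pseudomanifolds obtained from a tree of d-simplices T by identifications.
-- The cells are the classes of faces of T under an equivalence relation R
-- (R = _≡_ : no identification yet).

module _ {n : ℕ} where

  Rel₀ : Set₁
  Rel₀ = Subset n → Subset n → Set

  -- the cell [A] is a face of the cell [B]
  Below : Rel₀ → Subset n → Subset n → Set
  Below R A B = ∃₂ λ A' B' → R A A' × R B B' × A' ⊆ B'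

  -- the quotient of T by R is a d-pseudomanifold (simplicial regular CW)
  IsPseudomanifold : ℕ → Complex n → Rel₀ → Set
  IsPseudomanifold d T R =
    -- regular + simplicial: no two distinct faces of a d-simplex identified
    (∀ σ → IsFace d T σ → ∀ A B → A ⊆ σ → B ⊆ σ → R A B → A ≡ B) ×
    -- every (d-1)-cell lies in at most two d-cells
    (∀ F → face T F → ∣ F ∣ ≡ d → ∀ σ₁ σ₂ σ₃ →
       IsFace d T σ₁ → IsFace d T σ₂ → IsFace d T σ₃ →
       Below R F σ₁ → Below R F σ₂ → Below R F σ₃ →
       R σ₁ σ₂ ⊎ R σ₁ σ₃ ⊎ R σ₂ σ₃)

  BoundaryCell : ℕ → Complex n → Rel₀ → Subset n → Set
  BoundaryCell d T R F = face T F × ∣ F ∣ ≡ d ×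
    ∃ λ σ → IsFace d T σ × Below R F σ ×
      (∀ τ → IsFace d T τ → Below R F τ → R τ σ)

  IsImage : (Fin n → Fin n) → Subset n → Subset n → Set
  IsImage π A B = ∀ j → (j ∈ B → ∃ λ i → i ∈ A × π i ≡ j)
                      × (∀ i → i ∈ A → π i ≡ j → j ∈ B)

  InjectiveOn : (Fin n → Fin n) → Subset n → Set
  InjectiveOn π A = ∀ i j → i ∈ A → j ∈ A → π i ≡ π j → i ≡ j

  Glued : Rel₀ → Subset n → (Fin n → Fin n) → Rel₀
  Glued R F π = EqClosure (λ A B → R A B ⊎ (A ⊆ F × IsImage π A B))

-- t-LC: obtained from the tree T by successively identifying two distinct
-- boundary (d-1)-cells [F],[G] whose intersection has dimension ≥ d-1-t,
-- i.e. contains a common cell with ≥ d-t vertices; every stage is a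
-- d-pseudomanifold.
data LC {n : ℕ} (d t : ℕ) (T : Complex n) : Rel₀ {n} → Set₁ where
  start : LC d t T _≡_
  glue  : ∀ {R} → LC d t T R →
          (F G : Subset n) (π : Fin n → Fin n) →
          BoundaryCell d T R F → BoundaryCell d T R G → ¬ R F G →
          IsImage π F G → InjectiveOn π F →
          (∃₂ λ A B → A ⊆ F × B ⊆ G × R A B × d ∸ t ≤ ∣ A ∣) →
          IsPseudomanifold d T (Glued R F π) →
          LC d t T (Glued R F π)

module _ {n : ℕ} where

  CellAdj : ℕ → Complex n → Rel₀ {n} → Subset n → Subset n → Set
  CellAdj k T R A B = IsFace k T A × IsFace k T B ×
    (R A B ⊎ ∃ λ S → ∣ S ∣ ≡ k × Below R S A × Below R S B)

  CellStronglyConnected : ℕ → Complex n → Rel₀ {n} → Set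
  CellStronglyConnected k T R =
    ∀ A B → IsFace k T A → IsFace k T B → Star (CellAdj k T R) A B

{-# OPTIONS --safe #-}
-- Strong connectivity in dimension k survives gluing two complexes C₁, C₂ that
-- contain k-faces X₁ ∈ C₁, X₂ ∈ C₂ sharing at least k vertices: every k-face is
-- joined to X₁, those of C₂ through the single step X₂ — X₁.  In a t-constructible
-- gluing such faces are cut out of facets of C₁ and C₂ through a common facet of
-- C₁ ∩ C₂; in a tree of simplices, out of the old facet and the new simplex
-- through the attaching facet.  The base cases are the simplex (exchange one
-- vertex at a time) and the connected graph.  Identifying faces of a tree only
-- adds adjacencies between cells, so the tree's strong connectivity passes to
-- every quotient.  Neither t, nor the constructibility of the skeleton of
-- C₁ ∩ C₂, nor the side conditions of the LC identifications is ever used.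
module Submission where

open import Defs
open import Data.Nat using (ℕ; zero; suc; _≤_; _<_; z≤n; s≤s; _≤?_)
open import Data.Nat.Properties
  using (≤-trans; ≤-reflexive; ≤-antisym; ≤-<-trans; n≤1+n; 1+n≰n; ≰⇒>;
         m≤n⇒m<n∨m≡n; suc-injective)
open import Data.Fin as Fin using (Fin)
open import Data.Vec using ([]; _∷_; here; there)
open import Data.Fin.Subset
open import Data.Fin.Subset.Properties
open import Data.Product using (∃; ∃₂; _×_; _,_; proj₁; proj₂)
open import Data.Sum using (inj₁; inj₂)
open import Function using (_∘_)
open import Relation.Binary.Definitions using (Reflexive)
open import Relation.Binary.PropositionalEquality
  using (_≡_; refl; sym; trans; cong; subst)
open import Relation.Binary.Construct.Closure.ReflexiveTransitive
  using (Star; ε; _◅_; _◅◅_; gmap; reverse)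
import Relation.Binary.Construct.Closure.ReflexiveTransitive as Star
open import Relation.Nullary using (yes; no; contradiction)

private
  variable
    n k d t : ℕ
    p q r : Subset n
    x : Fin n
    A B F G G₁ G₂ X : Subset n
    C D C₁ C₂ : Complex n

p⊆q⇒∣q∣≤∣p∣⇒p≡q : p ⊆ q → ∣ q ∣ ≤ ∣ p ∣ → p ≡ q
p⊆q⇒∣q∣≤∣p∣⇒p≡q {p = []}          {[]}          _   _  = refl
p⊆q⇒∣q∣≤∣p∣⇒p≡q {p = outside ∷ p} {outside ∷ q} p⊆q le =
  cong (outside ∷_) (p⊆q⇒∣q∣≤∣p∣⇒p≡q (drop-∷-⊆ p⊆q) le)
p⊆q⇒∣q∣≤∣p∣⇒p≡q {p = inside ∷ p}  {inside ∷ q}  p⊆q (s≤s le) =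
  cong (inside ∷_) (p⊆q⇒∣q∣≤∣p∣⇒p≡q (drop-∷-⊆ p⊆q) le)
p⊆q⇒∣q∣≤∣p∣⇒p≡q {p = inside ∷ p}  {outside ∷ q} p⊆q _  = contradiction (p⊆q here) λ ()
p⊆q⇒∣q∣≤∣p∣⇒p≡q {p = outside ∷ p} {inside ∷ q}  p⊆q le =
  contradiction (≤-trans le (p⊆q⇒∣p∣≤∣q∣ (drop-∷-⊆ p⊆q))) 1+n≰n

⊆-interpolate : ∀ {m} → p ⊆ r → ∣ p ∣ ≤ m → m ≤ ∣ r ∣ →
                ∃ λ q → p ⊆ q × q ⊆ r × ∣ q ∣ ≡ m
⊆-interpolate {p = []} {[]} _ _ z≤n = [] , ⊆-refl , ⊆-refl , refl
⊆-interpolate {p = outside ∷ p} {outside ∷ r} p⊆r p≤m m≤r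
  with ⊆-interpolate (drop-∷-⊆ p⊆r) p≤m m≤r
... | q , p⊆q , q⊆r , ∣q∣ = outside ∷ q , out⊆ p⊆q , out⊆ q⊆r , ∣q∣
⊆-interpolate {p = inside ∷ p} {inside ∷ r} p⊆r (s≤s p≤m) (s≤s m≤r)
  with ⊆-interpolate (drop-∷-⊆ p⊆r) p≤m m≤r
... | q , p⊆q , q⊆r , ∣q∣ = inside ∷ q , in⊆in p⊆q , in⊆in q⊆r , cong suc ∣q∣
⊆-interpolate {p = inside ∷ p} {outside ∷ r} p⊆r _ _ = contradiction (p⊆r here) λ ()
⊆-interpolate {p = outside ∷ p} {inside ∷ r} {m} p⊆r p≤m m≤r with m ≤? ∣ r ∣
... | yes m≤∣r∣ with ⊆-interpolate (drop-∷-⊆ p⊆r) p≤m m≤∣r∣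
...   | q , p⊆q , q⊆r , ∣q∣ = outside ∷ q , out⊆ p⊆q , out⊆ q⊆r , ∣q∣
⊆-interpolate {p = outside ∷ p} {inside ∷ r} p⊆r p≤m m≤r | no m≰∣r∣ =
  inside ∷ r , p⊆r , ⊆-refl , ≤-antisym (≰⇒> m≰∣r∣) m≤r

∃-⊆-of-size : ∀ {n m} {p : Subset n} → m ≤ ∣ p ∣ → ∃ λ q → q ⊆ p × ∣ q ∣ ≡ m
∃-⊆-of-size {n} m≤∣p∣ with ⊆-interpolate ⊥⊆ (≤-trans (≤-reflexive (∣⊥∣≡0 n)) z≤n) m≤∣p∣
... | q , _ , q⊆p , ∣q∣ = q , q⊆p , ∣q∣

x∈p⇒0<∣p∣ : x ∈ p → 0 < ∣ p ∣
x∈p⇒0<∣p∣ here = s≤s z≤n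
x∈p⇒0<∣p∣ {p = s ∷ p} (there x∈p) = ≤-trans (x∈p⇒0<∣p∣ x∈p) (∣p∣≤∣x∷p∣ s p)

x∈p⇒⁅x⁆⊆p : x ∈ p → ⁅ x ⁆ ⊆ p
x∈p⇒⁅x⁆⊆p {p = p} x∈p y∈⁅x⁆ = subst (_∈ p) (sym (x∈⁅y⁆⇒x≡y _ y∈⁅x⁆)) x∈p

∣p∣≡1+k⇒nonempty : ∀ {n} {p : Subset n} → ∣ p ∣ ≡ suc k → Nonempty p
∣p∣≡1+k⇒nonempty {n = n} {p = p} ∣p∣ with nonempty? p
... | yes ne = ne
... | no ¬ne =
  contradiction (trans (sym ∣p∣) (trans (cong ∣_∣ (Empty-unique ¬ne)) (∣⊥∣≡0 n))) λ ()

p⊆q⇒∣p∩q∣≡∣p∣ : p ⊆ q → ∣ p ∩ q ∣ ≡ ∣ p ∣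
p⊆q⇒∣p∩q∣≡∣p∣ {p = p} {q} p⊆q =
  ≤-antisym (∣p∩q∣≤∣p∣ p q) (p⊆q⇒∣p∣≤∣q∣ (λ x∈p → x∈p∩q⁺ (x∈p , p⊆q x∈p)))

record _⊑_ (C D : Complex n) : Set where
  constructor subcomplex
  field ⊑-face : ∀ {F} → face C F → face D F
open _⊑_

IsFace-mono : C ⊑ D → IsFace k C F → IsFace k D F
IsFace-mono C⊑D (f , ∣F∣) = ⊑-face C⊑D f , ∣F∣

DualAdj-mono : C ⊑ D → DualAdj k C F G → DualAdj k D F G
DualAdj-mono {F = F} {G = G} C⊑D (fF , fG , ∣F∩G∣) =
  IsFace-mono {F = F} C⊑D fF , IsFace-mono {F = G} C⊑D fG , ∣F∩G∣

Star-DualAdj-mono : C ⊑ D → Star (DualAdj k C) F G → Star (DualAdj k D) F G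
Star-DualAdj-mono C⊑D = Star.map (λ {A} {B} → DualAdj-mono {F = A} {G = B} C⊑D)

DualAdj-sym : DualAdj k C F G → DualAdj k C G F
DualAdj-sym {F = F} {G} (fF , fG , ∣F∩G∣) = fG , fF , trans (cong ∣_∣ (∩-comm G F)) ∣F∩G∣

Star-DualAdj-sym : Star (DualAdj k C) F G → Star (DualAdj k C) G F
Star-DualAdj-sym {k = k} {C = C} =
  reverse (λ {F} {G} → DualAdj-sym {k = k} {C = C} {F = F} {G = G})

adjacent-or-equal : IsFace k C F → IsFace k C G → k ≤ ∣ F ∩ G ∣ → Star (DualAdj k C) F G
adjacent-or-equal {k = k} {C = C} {F = F} {G = G} fF fG k≤ with m≤n⇒m<n∨m≡n k≤
... | inj₂ k≡ = (fF , fG , sym k≡) ◅ ε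
... | inj₁ k< =
  subst (Star _ F) (trans (sym (F∩G≡ (p∩q⊆p F G) fF)) (F∩G≡ (p∩q⊆q F G) fG)) ε
  where
  F∩G≡ : ∀ {H} → F ∩ G ⊆ H → IsFace k C H → F ∩ G ≡ H
  F∩G≡ F∩G⊆H (_ , ∣H∣) = p⊆q⇒∣q∣≤∣p∣⇒p≡q F∩G⊆H (≤-trans (≤-reflexive ∣H∣) k<)

hub⇒stronglyConnected : (∀ A → IsFace k C A → Star (DualAdj k C) A X) → StronglyConnected k C
hub⇒stronglyConnected {C = C} to-X A B fA fB =
  to-X A fA ◅◅ Star-DualAdj-sym {C = C} (to-X B fB)

stronglyConnected-dim0 : StronglyConnected 0 C
stronglyConnected-dim0 {C = C} A B fA fB = adjacent-or-equal {C = C} fA fB z≤n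

stronglyConnected⇒skel : StronglyConnected k C → StronglyConnected k (skel k C)
stronglyConnected⇒skel {k = k} {C = C} sc F G ((fF , _) , ∣F∣) ((fG , _) , ∣G∣) =
  Star.map (λ {A} {B} (fA , fB , ∣A∩B∣) → toSkel {A} fA , toSkel {B} fB , ∣A∩B∣)
    (sc F G (fF , ∣F∣) (fG , ∣G∣))
  where
  toSkel : ∀ {A} → IsFace k C A → IsFace k (skel k C) A
  toSkel (f , ∣A∣) = (f , ≤-reflexive ∣A∣) , ∣A∣

edgePath⇒dualPath : ∀ {u v} → (∀ F → face C F → ∣ F ∣ ≤ 2) →
  Star (λ a b → face C (⁅ a ⁆ ∪ ⁅ b ⁆)) u v →
  IsFace 1 C A → IsFace 1 C B → u ∈ A → v ∈ B → Star (DualAdj 1 C) A B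
edgePath⇒dualPath {C = C} _ ε fA fB u∈A u∈B =
  adjacent-or-equal {C = C} fA fB (x∈p⇒0<∣p∣ (x∈p∩q⁺ (u∈A , u∈B)))
edgePath⇒dualPath {C = C} {u = u} dim (_◅_ {j = w} edge path) fA fB u∈A v∈B
  with u Fin.≟ w
... | yes refl = edgePath⇒dualPath {C = C} dim path fA fB u∈A v∈B
... | no u≢w =
  adjacent-or-equal {C = C} fA fE (x∈p⇒0<∣p∣ (x∈p∩q⁺ (u∈A , x∈p∪q⁺ (inj₁ (x∈⁅x⁆ u)))))
  ◅◅ edgePath⇒dualPath {C = C} dim path fE fB w∈E v∈B
  where
  E = ⁅ u ⁆ ∪ ⁅ w ⁆
  w∈E = x∈p∪q⁺ (inj₂ (x∈⁅x⁆ w))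
  ⁅u⁆⊂E : ⁅ u ⁆ ⊂ E
  ⁅u⁆⊂E = p⊆p∪q ⁅ w ⁆ , w , w∈E , u≢w ∘ sym ∘ x∈⁅y⁆⇒x≡y u
  fE : IsFace 1 C E
  fE = edge , ≤-antisym (dim E edge) (subst (_< ∣ E ∣) (∣⁅x⁆∣≡1 u) (p⊂q⇒∣p∣<∣q∣ ⁅u⁆⊂E))

connected⇒stronglyConnected-dim1 : HasDim 1 C → Connected C → StronglyConnected 1 C
connected⇒stronglyConnected-dim1 {C = C} (_ , dim) conn A B fA@(a , ∣A∣) fB@(b , ∣B∣)
  with ∣p∣≡1+k⇒nonempty ∣A∣ | ∣p∣≡1+k⇒nonempty ∣B∣
... | u , u∈A | v , v∈B =
  edgePath⇒dualPath {C = C} dim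
    (conn u v (closed C (x∈p⇒⁅x⁆⊆p u∈A) a) (closed C (x∈p⇒⁅x⁆⊆p v∈B) b))
    fA fB u∈A v∈B

Δ : Subset n → Complex n
Δ σ = record { face = _⊆ σ ; closed = ⊆-trans }

Δ-DualAdj-outside : ∀ {U : Subset n} s → DualAdj k (Δ U) A B →
                    DualAdj k (Δ (s ∷ U)) (outside ∷ A) (outside ∷ B)
Δ-DualAdj-outside _ ((A⊆U , ∣A∣) , (B⊆U , ∣B∣) , ∣A∩B∣) =
  (out⊆ A⊆U , ∣A∣) , (out⊆ B⊆U , ∣B∣) , ∣A∩B∣

Δ-DualAdj-inside : ∀ {U : Subset n} → DualAdj k (Δ U) A B →
                   DualAdj (suc k) (Δ (inside ∷ U)) (inside ∷ A) (inside ∷ B)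
Δ-DualAdj-inside ((A⊆U , ∣A∣) , (B⊆U , ∣B∣) , ∣A∩B∣) =
  (in⊆in A⊆U , cong suc ∣A∣) , (in⊆in B⊆U , cong suc ∣B∣) , cong suc ∣A∩B∣

Δ-inside-outside : ∀ {U : Subset n} → StronglyConnected k (Δ U) →
  IsFace k (Δ (inside ∷ U)) (inside ∷ p) → IsFace k (Δ (inside ∷ U)) (outside ∷ q) →
  Star (DualAdj k (Δ (inside ∷ U))) (inside ∷ p) (outside ∷ q)
Δ-inside-outside {k = k} {p = p} {q = q} {U = U} sc (p⊆ , ∣p∣) (q⊆ , ∣q∣)
  with ⊆-interpolate (drop-∷-⊆ p⊆) (≤-trans (≤-reflexive (suc-injective ∣p∣)) (n≤1+n k))
                                    (≤-trans (≤-reflexive (sym ∣q∣)) (p⊆q⇒∣p∣≤∣q∣ (drop-∷-⊆ q⊆)))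
... | p' , p⊆p' , p'⊆U , ∣p'∣ =
  exchange ◅ gmap (outside ∷_) (Δ-DualAdj-outside inside)
                  (sc p' q (p'⊆U , ∣p'∣) (drop-∷-⊆ q⊆ , ∣q∣))
  where
  exchange : DualAdj k (Δ (inside ∷ U)) (inside ∷ p) (outside ∷ p')
  exchange = (p⊆ , ∣p∣) , (out⊆ p'⊆U , ∣p'∣) , trans (p⊆q⇒∣p∩q∣≡∣p∣ p⊆p') (suc-injective ∣p∣)

Δ-stronglyConnected : ∀ k (U : Subset n) → StronglyConnected k (Δ U)
Δ-stronglyConnected zero U = stronglyConnected-dim0 {C = Δ U}
Δ-stronglyConnected (suc k) [] [] [] (_ , ()) _
Δ-stronglyConnected (suc k) (s ∷ U) (outside ∷ p) (outside ∷ q) (p⊆ , ∣p∣) (q⊆ , ∣q∣) =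
  gmap (outside ∷_) (Δ-DualAdj-outside s)
    (Δ-stronglyConnected (suc k) U p q (drop-∷-⊆ p⊆ , ∣p∣) (drop-∷-⊆ q⊆ , ∣q∣))
Δ-stronglyConnected (suc k) (outside ∷ U) (inside ∷ p) _ (p⊆ , _) _ =
  contradiction (p⊆ here) λ ()
Δ-stronglyConnected (suc k) (outside ∷ U) (outside ∷ p) (inside ∷ q) _ (q⊆ , _) =
  contradiction (q⊆ here) λ ()
Δ-stronglyConnected (suc k) (inside ∷ U) (inside ∷ p) (inside ∷ q) (p⊆ , ∣p∣) (q⊆ , ∣q∣) =
  gmap (inside ∷_) Δ-DualAdj-inside
    (Δ-stronglyConnected k U p q (drop-∷-⊆ p⊆ , suc-injective ∣p∣)
                                  (drop-∷-⊆ q⊆ , suc-injective ∣q∣))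
Δ-stronglyConnected (suc k) (inside ∷ U) (inside ∷ p) (outside ∷ q) fp fq =
  Δ-inside-outside (Δ-stronglyConnected (suc k) U) fp fq
Δ-stronglyConnected (suc k) (inside ∷ U) (outside ∷ p) (inside ∷ q) fp fq =
  Star-DualAdj-sym {C = Δ (inside ∷ U)}
    (Δ-inside-outside (Δ-stronglyConnected (suc k) U) fq fp)

simplex⇒stronglyConnected : IsSimplex C → StronglyConnected k C
simplex⇒stronglyConnected {C = C} {k = k} (σ , h) F G fF fG =
  Star-DualAdj-mono Δσ⊑C
    (Δ-stronglyConnected k σ F G (IsFace-mono {F = F} C⊑Δσ fF) (IsFace-mono {F = G} C⊑Δσ fG))
  where
  C⊑Δσ : C ⊑ Δ σ
  C⊑Δσ = subcomplex λ {F} → proj₁ (h F)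
  Δσ⊑C : Δ σ ⊑ C
  Δσ⊑C = subcomplex λ {F} → proj₂ (h F)

Linked : ℕ → Complex n → Complex n → Set
Linked k C₁ C₂ = ∃₂ λ X₁ X₂ → IsFace k C₁ X₁ × IsFace k C₂ X₂ × k ≤ ∣ X₁ ∩ X₂ ∣

linked-through : face C₁ G₁ → face C₂ G₂ → F ⊆ G₁ → F ⊆ G₂ →
                 k ≤ ∣ F ∣ → k < ∣ G₁ ∣ → k < ∣ G₂ ∣ → Linked k C₁ C₂
linked-through {C₁ = C₁} {C₂ = C₂} {k = k} g₁ g₂ F⊆G₁ F⊆G₂ k≤∣F∣ k<∣G₁∣ k<∣G₂∣
  with ∃-⊆-of-size k≤∣F∣
... | Y , Y⊆F , ∣Y∣
  with ⊆-interpolate (⊆-trans Y⊆F F⊆G₁) ∣Y∣≤1+k k<∣G₁∣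
     | ⊆-interpolate (⊆-trans Y⊆F F⊆G₂) ∣Y∣≤1+k k<∣G₂∣
  where
  ∣Y∣≤1+k = ≤-trans (≤-reflexive ∣Y∣) (n≤1+n k)
... | X₁ , Y⊆X₁ , X₁⊆G₁ , ∣X₁∣ | X₂ , Y⊆X₂ , X₂⊆G₂ , ∣X₂∣ =
  X₁ , X₂ , (closed C₁ X₁⊆G₁ g₁ , ∣X₁∣) , (closed C₂ X₂⊆G₂ g₂ , ∣X₂∣) ,
  ≤-trans (≤-reflexive (sym ∣Y∣)) (p⊆q⇒∣p∣≤∣q∣ (λ y∈Y → x∈p∩q⁺ (Y⊆X₁ y∈Y , Y⊆X₂ y∈Y)))

stronglyConnected-∪ : IsUnion C C₁ C₂ → Linked k C₁ C₂ →
  StronglyConnected k C₁ → StronglyConnected k C₂ → StronglyConnected k C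
stronglyConnected-∪ {C = C} {C₁ = C₁} {C₂ = C₂} {k = k}
  C≡C₁∪C₂ (X₁ , X₂ , fX₁ , fX₂ , link) sc₁ sc₂ =
  hub⇒stronglyConnected {C = C} to-X₁
  where
  C₁⊑C : C₁ ⊑ C
  C₁⊑C = subcomplex λ {F} f → proj₂ (C≡C₁∪C₂ F) (inj₁ f)
  C₂⊑C : C₂ ⊑ C
  C₂⊑C = subcomplex λ {F} f → proj₂ (C≡C₁∪C₂ F) (inj₂ f)
  to-X₁ : ∀ A → IsFace k C A → Star (DualAdj k C) A X₁
  to-X₁ A (fA , ∣A∣) with proj₁ (C≡C₁∪C₂ A) fA
  ... | inj₁ f₁ = Star-DualAdj-mono C₁⊑C (sc₁ A X₁ (f₁ , ∣A∣) fX₁)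
  ... | inj₂ f₂ =
    Star-DualAdj-mono C₂⊑C (sc₂ A X₂ (f₂ , ∣A∣) fX₂) ◅◅
    Star-DualAdj-sym {C = C}
      (adjacent-or-equal {C = C} (IsFace-mono {F = X₁} C₁⊑C fX₁)
                                 (IsFace-mono {F = X₂} C₂⊑C fX₂) link)

simplex-facet : IsSimplex C → HasDim d C → face C F → ∃ λ G → IsFace d C G × F ⊆ G
simplex-facet {F = F} (σ , h) ((X , fX , ∣X∣) , dim) fF =
  σ , (fσ , ≤-antisym (dim σ fσ) (subst (_≤ ∣ σ ∣) ∣X∣ (p⊆q⇒∣p∣≤∣q∣ (proj₁ (h X) fX)))) ,
  proj₁ (h F) fF
  where
  fσ = proj₂ (h σ) ⊆-refl

tConstructible-facet : TConstructible t (suc (suc d)) C → face C F →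
                       ∃ λ G → IsFace (suc (suc d)) C G × F ⊆ G
tConstructible-facet {C = C} (simplex s dim)                 fF = simplex-facet {C = C} s dim fF
tConstructible-facet {F = F} (glue (_ , pure) _ _ _ _ _ _ _) fF = pure F fF

tConstructible⇒stronglyConnected : TConstructible t d C → ∀ k → k ≤ d → StronglyConnected k C
tConstructible⇒stronglyConnected {C = C} (simplex s _) k _ = simplex⇒stronglyConnected {C = C} s
tConstructible⇒stronglyConnected {C = C} (graph _ _) zero _ = stronglyConnected-dim0 {C = C}
tConstructible⇒stronglyConnected {C = C} (graph dim conn) 1 _ =
  connected⇒stronglyConnected-dim1 {C = C} dim conn
tConstructible⇒stronglyConnected (graph _ _) (suc (suc _)) (s≤s ())
tConstructible⇒stronglyConnected {C = C}
  (glue {C₁ = C₁} {C₂ = C₂} _ _ tc₁ tc₂ C≡C₁∪C₂ D≡C₁∩C₂ (((f , fD , ∣f∣) , _) , _) _) k k≤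
  with tConstructible-facet tc₁ (proj₁ (proj₁ (D≡C₁∩C₂ f) fD))
     | tConstructible-facet tc₂ (proj₂ (proj₁ (D≡C₁∩C₂ f) fD))
... | G₁ , (g₁ , ∣G₁∣) , f⊆G₁ | G₂ , (g₂ , ∣G₂∣) , f⊆G₂ =
  stronglyConnected-∪ {C = C} {C₁ = C₁} {C₂ = C₂} C≡C₁∪C₂
    (linked-through {C₁ = C₁} {C₂ = C₂} g₁ g₂ f⊆G₁ f⊆G₂ (subst (k ≤_) (sym ∣f∣) k≤)
      (subst (k <_) (sym ∣G₁∣) (s≤s k≤)) (subst (k <_) (sym ∣G₂∣) (s≤s k≤)))
    (tConstructible⇒stronglyConnected tc₁ k k≤) (tConstructible⇒stronglyConnected tc₂ k k≤)

tree⇒stronglyConnected : TreeOfSimplices d C → ∀ k → k ≤ d → StronglyConnected k C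
tree⇒stronglyConnected {C = C} (single s _) k _ = simplex⇒stronglyConnected {C = C} s
tree⇒stronglyConnected {C = C}
  (attach {C'} tree F v (fF , ∣F∣ , σ , (fσ , ∣σ∣) , F⊆σ , _) v∉C' C≡C'∪τ) k k≤ =
  stronglyConnected-∪ {C = C} {C₁ = C'} {C₂ = Δ τ} C≡C'∪τ
    (linked-through {C₁ = C'} {C₂ = Δ τ} fσ ⊆-refl F⊆σ F⊆τ k≤∣F∣
      (subst (k <_) (sym ∣σ∣) (s≤s k≤)) (≤-<-trans k≤∣F∣ (p⊂q⇒∣p∣<∣q∣ F⊂τ)))
    (tree⇒stronglyConnected tree k k≤) (Δ-stronglyConnected k τ)
  where
  τ = F ∪ ⁅ v ⁆
  F⊆τ = p⊆p∪q ⁅ v ⁆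
  k≤∣F∣ = subst (k ≤_) (sym ∣F∣) k≤
  F⊂τ : F ⊂ τ
  F⊂τ = F⊆τ , v , x∈p∪q⁺ (inj₂ (x∈⁅x⁆ v)) , λ v∈F → v∉C' (closed C' (x∈p⇒⁅x⁆⊆p v∈F) fF)

LC⇒reflexive : ∀ {T : Complex n} {R} → LC d t T R → Reflexive R
LC⇒reflexive start                        = refl
LC⇒reflexive (glue _ _ _ _ _ _ _ _ _ _ _) = ε

⊆⇒Below : ∀ {R : Rel₀ {n}} → Reflexive R → A ⊆ B → Below R A B
⊆⇒Below R-refl A⊆B = _ , _ , R-refl , R-refl , A⊆B

dualAdj⇒cellAdj : ∀ {T : Complex n} {R} → Reflexive R → DualAdj k T A B → CellAdj k T R A B
dualAdj⇒cellAdj {A = A} {B = B} {R = R} R-refl (fA , fB , ∣A∩B∣) =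
  fA , fB , inj₂ (A ∩ B , ∣A∩B∣ , ⊆⇒Below {R = R} R-refl (p∩q⊆p A B) ,
                                 ⊆⇒Below {R = R} R-refl (p∩q⊆q A B))

stronglyConnected⇒cellStronglyConnected : ∀ {T : Complex n} {R} → Reflexive R →
  StronglyConnected k T → CellStronglyConnected k T R
stronglyConnected⇒cellStronglyConnected {k = k} {T = T} R-refl sc A B fA fB =
  Star.map (λ {P} {Q} → dualAdj⇒cellAdj {k = k} {A = P} {B = Q} {T = T} R-refl) (sc A B fA fB)

lemma2p7 : ∀ {n : ℕ} (t d : ℕ) → 1 ≤ t → t ≤ d →
    (∀ (C : Complex n) → HasDim d C → TConstructible t d C →
       ∀ k → k ≤ d → StronglyConnected k (skel k C))
    ×
    (∀ (T : Complex n) → TreeOfSimplices d T → ∀ R → LC d t T R →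
       IsPseudomanifold d T R →
       ∀ k → k ≤ d → CellStronglyConnected k T R)
lemma2p7 t d _ _ =
  (λ C _ tc k k≤d →
     stronglyConnected⇒skel {C = C} (tConstructible⇒stronglyConnected tc k k≤d)) ,
  (λ T tree R lc _ k k≤d →
     stronglyConnected⇒cellStronglyConnected {T = T} (LC⇒reflexive lc)
       (tree⇒stronglyConnected tree k k≤d))
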